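{- For every $\alpha\in2^\omega$ we have $s^{\rightarrow}_{\alpha,\alpha}\equiv_{sW}s^{\leftarrow}_{\alpha,\alpha}\equiv_{sW}s^{\leftrightarrow}_{\alpha,\alpha}$.
   Context: Cantor space $2^\omega$ carries the lexicographic order $<_{lex}$. For $\alpha\in2^\omega$, $s_\alpha(x)=0$ if $x<_{lex}\alpha$ and $1$ otherwise. For a truth-table $F\colon\{0,1\}^2\to\{0,1\}$, $s^F_{\alpha,\alpha}(x,y)=F(s_\alpha(x),s_\alpha(y))$; $\rightarrow$ is implication $(a,b)\mapsto(a\to b)$, $\leftarrow$ is $(a,b)\mapsto(b\to a)$, and $\leftrightarrow$ is the biconditional. $f\le_{sW}g$ means there are computable functionals $\Phi,\Psi$ with $f(x)=\Psi(g(\Phi(x)))$ for all $x$; $\equiv_{sW}$ means reducibility in both directions. -}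

module Defs where

open import Data.Nat using (ℕ; zero; suc; _<_; _*_; _+_)
open import Data.Bool using (Bool; true; false; not; _∧_; _∨_)
open import Data.Vec using (Vec; []; _∷_)
open import Data.Fin using (Fin)
open import Data.Product using (Σ; _×_; _,_; ∃)
open import Data.Sum using (_⊎_)
open import Relation.Nullary using (¬_)
open import Relation.Binary.PropositionalEquality using (_≡_)

Cantor : Set
Cantor = ℕ → Bool

_<lex_ : Cantor → Cantor → Set
x <lex α = Σ ℕ λ n → (∀ m → m < n → x m ≡ α m) × (x n ≡ false) × (α n ≡ true)

-- Single-valued total functions are given as their graphs (relations),
-- since s_α is not a constructively definable Agda function.

Graph : Set → Set → Set₁
Graph A B = A → B → Set

s : Cantor → Graph Cantor Bool
s α x b = (b ≡ false × x <lex α) ⊎ (b ≡ true × ¬ (x <lex α))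

TruthTable : Set
TruthTable = Bool → Bool → Bool

_⇒ᵇ_ : Bool → Bool → Bool
a ⇒ᵇ b = not a ∨ b

impl : TruthTable
impl a b = a ⇒ᵇ b

revImpl : TruthTable
revImpl a b = b ⇒ᵇ a

biimpl : TruthTable
biimpl a b = (a ⇒ᵇ b) ∧ (b ⇒ᵇ a)

sF : TruthTable → Cantor → Graph (Cantor × Cantor) Bool
sF F α (x , y) c = ∃ λ a → ∃ λ b → s α x a × s α y b × c ≡ F a b

data Code : ℕ → Set where
  zer  : ∀ {k} → Code k
  succ : Code 1
  proj : ∀ {k} → Fin k → Code k
  comp : ∀ {k m} → Code m → Vec (Code k) m → Code k
  prec : ∀ {k} → Code k → Code (suc (suc k)) → Code (suc k)
  mu   : ∀ {k} → Code (suc k) → Code k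
  orc  : Code 1

Oracle : Set
Oracle = ℕ → ℕ

mutual
  data Eval (o : Oracle) : ∀ {k} → Code k → Vec ℕ k → ℕ → Set where
    ev-zer  : ∀ {k} {xs : Vec ℕ k} → Eval o zer xs 0
    ev-succ : ∀ {n} → Eval o succ (n ∷ []) (suc n)
    ev-proj : ∀ {k} {i} {xs : Vec ℕ k} → Eval o (proj i) xs (Data.Vec.lookup xs i)
    ev-comp : ∀ {k m} {f : Code m} {gs : Vec (Code k) m} {xs : Vec ℕ k}
                {ys : Vec ℕ m} {r : ℕ} →
              EvalAll o gs xs ys → Eval o f ys r → Eval o (comp f gs) xs r
    ev-prec-z : ∀ {k} {g : Code k} {h : Code (suc (suc k))} {xs : Vec ℕ k} {r : ℕ} →
              Eval o g xs r → Eval o (prec g h) (zero ∷ xs) r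
    ev-prec-s : ∀ {k} {g : Code k} {h : Code (suc (suc k))} {xs : Vec ℕ k}
                  {n r r' : ℕ} →
              Eval o (prec g h) (n ∷ xs) r' → Eval o h (n ∷ r' ∷ xs) r →
              Eval o (prec g h) (suc n ∷ xs) r
    ev-mu   : ∀ {k} {f : Code (suc k)} {xs : Vec ℕ k} {n : ℕ} →
              Eval o f (n ∷ xs) 0 →
              (∀ m → m < n → ∃ λ j → Eval o f (m ∷ xs) (suc j)) →
              Eval o (mu f) xs n
    ev-orc  : ∀ {n} → Eval o orc (n ∷ []) (o n)

  data EvalAll (o : Oracle) {k : ℕ} : ∀ {m} → Vec (Code k) m → Vec ℕ k → Vec ℕ m → Set where
    []  : ∀ {xs} → EvalAll o [] xs []
    _∷_ : ∀ {m} {g : Code k} {gs : Vec (Code k) m} {xs : Vec ℕ k} {y : ℕ} {ys : Vec ℕ m} →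
          Eval o g xs y → EvalAll o gs xs ys → EvalAll o (g ∷ gs) xs (y ∷ ys)

bit : Bool → ℕ
bit false = 0
bit true  = 1

asOracle : Cantor → Oracle
asOracle x n = bit (x n)

ComputesC : Code 1 → (Cantor → Cantor) → Set
ComputesC c G = ∀ x n → Eval (asOracle x) c (n ∷ []) (bit (G x n))

ComputablePair : (Cantor × Cantor → Cantor × Cantor) → Set
ComputablePair Φ =
  (∃ λ c₁ → ComputesC c₁ (λ z → Data.Product.proj₁ (Φ (split z)))) ×
  (∃ λ c₂ → ComputesC c₂ (λ z → Data.Product.proj₂ (Φ (split z))))
  where
    split : Cantor → Cantor × Cantor
    split z = (λ n → z (2 * n)) , (λ n → z (suc (2 * n)))

-- Any Ψ : {0,1} → {0,1} is computable,
-- so the backward functional is an arbitrary Bool → Bool.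
_≤sW_ : Graph (Cantor × Cantor) Bool → Graph (Cantor × Cantor) Bool → Set
f ≤sW g = ∃ λ (Φ : Cantor × Cantor → Cantor × Cantor) → ∃ λ (Ψ : Bool → Bool) →
  ComputablePair Φ × (∀ z v → g (Φ z) v → f z (Ψ v))

_≡sW_ : Graph (Cantor × Cantor) Bool → Graph (Cantor × Cantor) Bool → Set
f ≡sW g = (f ≤sW g) × (g ≤sW f)

{-# OPTIONS --safe #-}

-- The map s_α is a lattice homomorphism from 2^ω, ordered
-- lexicographically, to {0,1}: s_α (min x y) = s_α x ∧ s_α y and
-- s_α (max x y) = s_α x ∨ s_α y.  Lexicographic min and max are computable:
-- read x and y in parallel, output x ∧ y resp. x ∨ y while they agree, and
-- copy the smaller resp. larger one after the first difference.  So the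
-- computable maps (x , y) ↦ (y , x), (max x y , x) and (min x y , max x y)
-- give the reductions, by the Boolean identities  (a → b) = (b ← a),
-- (a ← b) = ((a ∨ b) ↔ a)  and  (a ↔ b) = ((a ∧ b) ← (a ∨ b)).
-- Excluded middle is needed only to make s_α and the lexicographic order total.

module Submission where

open import Defs
open import Data.Product using (_×_)
open import Axiom.ExcludedMiddle using (ExcludedMiddle)
import Level

open import Data.Bool using (Bool; true; false; _∧_; _∨_; if_then_else_; _≤_; b≤b; f≤t)
open import Data.Bool.Properties
  using (∧-idem; ∨-idem; ∧-comm; ∨-comm; ≤-reflexive; ≤-minimum; ≤-maximum)
  renaming (_≟_ to _≟ᵇ_)
open import Data.Empty using (⊥-elim)
open import Data.Fin using (#_)
open import Data.Nat using (ℕ; zero; suc; pred; _<_; _*_; s≤s)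
open import Data.Nat.Induction using (<-rec)
open import Data.Nat.Properties using (<-cmp; <-trans; *-suc; m≤n⇒m<n∨m≡n; m<n⇒m<1+n; n<1+n)
open import Data.Product using (∃; _,_; proj₁; proj₂)
open import Data.Sum using (_⊎_; inj₁; inj₂)
open import Data.Vec using (Vec; []; _∷_)
open import Function using (id; const; constᵣ)
open import Relation.Binary.Definitions using (tri<; tri≈; tri>)
open import Relation.Binary.PropositionalEquality
  using (_≡_; _≢_; _≗_; refl; sym; trans; cong; subst; subst₂; module ≡-Reasoning)
open import Relation.Nullary using (yes; no)
open import Relation.Nullary.Decidable using (decidable-stable)

private
  variable
    o : Oracle
    k m : ℕ
    xs : Vec ℕ k
    x y : Cantor
    a b c : Bool

LEM : Set₁
LEM = ExcludedMiddle Level.zero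

if0_then_else_ : {A : Set} → ℕ → A → A → A
if0 zero  then p else q = p
if0 suc _ then p else q = q

ifz : Code k → Code k → Code k → Code k
ifz c d e = comp (prec (proj (# 0)) (proj (# 3))) (c ∷ d ∷ e ∷ [])

ifz-eval : ∀ {c d e : Code k} {p q} →
  Eval o c xs m → Eval o d xs p → Eval o e xs q → Eval o (ifz c d e) xs (if0 m then p else q)
ifz-eval {o = o} {xs = xs} {m = m} {p = p} {q} ec ed ee = ev-comp (ec ∷ ed ∷ ee ∷ []) (branch m)
  where
  branch : ∀ m → Eval o (prec (proj (# 0)) (proj (# 3))) (m ∷ p ∷ q ∷ []) (if0 m then p else q)
  branch zero    = ev-prec-z ev-proj
  branch (suc m) = ev-prec-s (branch m) ev-proj

ifz-if-eval : ∀ {c d e : Code k} {p q} →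
  Eval o c xs (bit a) → Eval o d xs p → Eval o e xs q → Eval o (ifz c d e) xs (if a then q else p)
ifz-if-eval {a = false} ec ed ee = ifz-eval ec ed ee
ifz-if-eval {a = true}  ec ed ee = ifz-eval ec ed ee

one : Code k
one = comp succ (zer ∷ [])

two : Code k
two = comp succ (one ∷ [])

one-eval : Eval o one xs 1
one-eval = ev-comp (ev-zer ∷ []) ev-succ

two-eval : Eval o two xs 2
two-eval = ev-comp (one-eval ∷ []) ev-succ

predCode : Code 1
predCode = prec zer (proj (# 0))

pred-eval : ∀ n → Eval o predCode (n ∷ []) (pred n)
pred-eval zero    = ev-prec-z ev-zer
pred-eval (suc n) = ev-prec-s (pred-eval n) ev-proj

doubleCode : Code 1
doubleCode = prec zer (comp succ (comp succ (proj (# 1) ∷ []) ∷ []))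

double-eval : ∀ n → Eval o doubleCode (n ∷ []) (2 * n)
double-eval zero    = ev-prec-z ev-zer
double-eval (suc n) = subst (Eval _ doubleCode (suc n ∷ [])) (sym (*-suc 2 n))
  (ev-prec-s (double-eval n) (ev-comp (ev-comp (ev-proj ∷ []) ev-succ ∷ []) ev-succ))

andCode orCode : Code k → Code k → Code k
andCode c d = ifz c zer d
orCode  c d = ifz c d one

and-eval : ∀ {c d : Code k} →
  Eval o c xs (bit a) → Eval o d xs (bit b) → Eval o (andCode c d) xs (bit (a ∧ b))
and-eval {a = false} ec ed = ifz-eval ec ev-zer ed
and-eval {a = true}  ec ed = ifz-eval ec ev-zer ed

or-eval : ∀ {c d : Code k} →
  Eval o c xs (bit a) → Eval o d xs (bit b) → Eval o (orCode c d) xs (bit (a ∨ b))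
or-eval {a = false} ec ed = ifz-eval ec ed one-eval
or-eval {a = true}  ec ed = ifz-eval ec ed one-eval

pick : {A : Set} → ℕ → A → A → A → A
pick zero          p q r = p
pick (suc zero)    p q r = q
pick (suc (suc _)) p q r = r

pickCode : Code 1 → Code 1 → Code 1 → Code 1 → Code 1
pickCode c₀ c₁ c₂ c₃ = ifz c₀ c₁ (ifz (comp predCode (c₀ ∷ [])) c₂ c₃)

pick-eval : ∀ {c₀ c₁ c₂ c₃ : Code 1} {n m} →
  Eval o c₀ (n ∷ []) m → Eval o c₁ (n ∷ []) (bit a) → Eval o c₂ (n ∷ []) (bit b) →
  Eval o c₃ (n ∷ []) (bit c) → Eval o (pickCode c₀ c₁ c₂ c₃) (n ∷ []) (bit (pick m a b c))
pick-eval {m = zero} e₀ e₁ e₂ e₃ =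
  ifz-eval e₀ e₁ (ifz-eval (ev-comp (e₀ ∷ []) (pred-eval _)) e₂ e₃)
pick-eval {m = suc zero} e₀ e₁ e₂ e₃ =
  ifz-eval e₀ e₁ (ifz-eval (ev-comp (e₀ ∷ []) (pred-eval _)) e₂ e₃)
pick-eval {m = suc (suc _)} e₀ e₁ e₂ e₃ =
  ifz-eval e₀ e₁ (ifz-eval (ev-comp (e₀ ∷ []) (pred-eval _)) e₂ e₃)

Computes : Oracle → Code 1 → Cantor → Set
Computes o c x = ∀ n → Eval o c (n ∷ []) (bit (x n))

evens odds : Cantor → Cantor
evens z n = z (2 * n)
odds  z n = z (suc (2 * n))

evensCode oddsCode : Code 1
evensCode = comp orc (doubleCode ∷ [])
oddsCode  = comp orc (comp succ (doubleCode ∷ []) ∷ [])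

evens-computes : ∀ z → Computes (asOracle z) evensCode (evens z)
evens-computes z n = ev-comp (double-eval n ∷ []) ev-orc

odds-computes : ∀ z → Computes (asOracle z) oddsCode (odds z)
odds-computes z n = ev-comp (ev-comp (double-eval n ∷ []) ev-succ ∷ []) ev-orc

ComputableOp : (Cantor → Cantor → Cantor) → Set
ComputableOp _⊙_ = ∃ λ c → ∀ z → Computes (asOracle z) c (evens z ⊙ odds z)

const-computable : ComputableOp const
const-computable = evensCode , evens-computes

constᵣ-computable : ComputableOp constᵣ
constᵣ-computable = oddsCode , odds-computes

-- prefixComparison x y n records how x and y compare below n: 0 if they agree
-- there, otherwise 1 or 2 according as x or y has the 0 at their first difference.
compareBits : Bool → Bool → ℕ
compareBits a b = if a then (if b then 0 else 2) else (if b then 1 else 0)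

prefixComparison : Cantor → Cantor → ℕ → ℕ
prefixComparison x y zero    = 0
prefixComparison x y (suc n) =
  if0 prefixComparison x y n then compareBits (x n) (y n) else prefixComparison x y n

lexMin lexMax : Cantor → Cantor → Cantor
lexMin x y n = pick (prefixComparison x y n) (x n ∧ y n) (x n) (y n)
lexMax x y n = pick (prefixComparison x y n) (x n ∨ y n) (y n) (x n)

compareCode : Code k → Code k → Code k
compareCode c d = ifz c (ifz d zer one) (ifz d two zer)

compare-eval : ∀ {c d : Code k} →
  Eval o c xs (bit a) → Eval o d xs (bit b) → Eval o (compareCode c d) xs (compareBits a b)
compare-eval ec ed = ifz-if-eval ec (ifz-if-eval ed ev-zer one-eval) (ifz-if-eval ed two-eval ev-zer)

prefixComparisonCode : Code 1 → Code 1 → Code 1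
prefixComparisonCode cx cy = prec zer
  (ifz (proj (# 1)) (compareCode (comp cx (proj (# 0) ∷ [])) (comp cy (proj (# 0) ∷ []))) (proj (# 1)))

lexMinCode lexMaxCode : Code 1 → Code 1 → Code 1
lexMinCode cx cy = pickCode (prefixComparisonCode cx cy) (andCode cx cy) cx cy
lexMaxCode cx cy = pickCode (prefixComparisonCode cx cy) (orCode cx cy) cy cx

module _ {cx cy : Code 1} (hx : Computes o cx x) (hy : Computes o cy y) where

  prefixComparison-eval : ∀ n → Eval o (prefixComparisonCode cx cy) (n ∷ []) (prefixComparison x y n)
  prefixComparison-eval zero    = ev-prec-z ev-zer
  prefixComparison-eval (suc n) = ev-prec-s (prefixComparison-eval n)
    (ifz-eval ev-proj
      (compare-eval (ev-comp (ev-proj ∷ []) (hx n)) (ev-comp (ev-proj ∷ []) (hy n))) ev-proj)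

  lexMin-computes : Computes o (lexMinCode cx cy) (lexMin x y)
  lexMin-computes n = pick-eval (prefixComparison-eval n) (and-eval (hx n) (hy n)) (hx n) (hy n)

  lexMax-computes : Computes o (lexMaxCode cx cy) (lexMax x y)
  lexMax-computes n = pick-eval (prefixComparison-eval n) (or-eval (hx n) (hy n)) (hy n) (hx n)

lexMin-computable : ComputableOp lexMin
lexMin-computable = lexMinCode evensCode oddsCode , λ z → lexMin-computes (evens-computes z) (odds-computes z)

lexMax-computable : ComputableOp lexMax
lexMax-computable = lexMaxCode evensCode oddsCode , λ z → lexMax-computes (evens-computes z) (odds-computes z)

AgreeBelow : Cantor → Cantor → ℕ → Set
AgreeBelow x y k = ∀ m → m < k → x m ≡ y m

<lex-respˡ-≗ : ∀ {α} → x ≗ y → x <lex α → y <lex α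
<lex-respˡ-≗ x≗y (k , ag , xk , αk) =
  k , (λ m m<k → trans (sym (x≗y m)) (ag m m<k)) , trans (sym (x≗y k)) xk , αk

<lex-trans : ∀ {α} → x <lex y → y <lex α → x <lex α
<lex-trans (k , agk , xk , yk) (j , agj , yj , αj) with <-cmp k j
... | tri< k<j _ _ = k , (λ m m<k → trans (agk m m<k) (agj m (<-trans m<k k<j))) ,
                     xk , trans (sym (agj k k<j)) yk
... | tri≈ _ refl _ with () ← trans (sym yj) yk
... | tri> _ _ j<k = j , (λ m m<j → trans (agk m (<-trans m<j j<k)) (agj m m<j)) ,
                     trans (agk j j<k) yj , αj

_≤lex_ : Cantor → Cantor → Set
x ≤lex y = x <lex y ⊎ x ≗ y

≤lex-<lex-trans : ∀ {α} → x ≤lex y → y <lex α → x <lex α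
≤lex-<lex-trans (inj₁ x<y) y<α = <lex-trans x<y y<α
≤lex-<lex-trans (inj₂ x≗y) y<α = <lex-respˡ-≗ (λ n → sym (x≗y n)) y<α

agree-or-differ : LEM → ∀ x y → x ≗ y ⊎ ∃ λ k → AgreeBelow x y k × x k ≢ y k
agree-or-differ lem x y with lem {∃ λ k → AgreeBelow x y k × x k ≢ y k}
... | yes differ = inj₂ differ
... | no ¬differ = inj₁ (<-rec _ λ n agree-below →
        decidable-stable (x n ≟ᵇ y n) λ xn≢yn → ¬differ (n , (λ m → agree-below) , xn≢yn))

≤lex-total : LEM → ∀ x y → x ≤lex y ⊎ y ≤lex x
≤lex-total lem x y with agree-or-differ lem x y
... | inj₁ x≗y = inj₁ (inj₂ x≗y)
... | inj₂ (k , ag , xk≢yk) with x k in xk | y k in yk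
...   | false | true  = inj₁ (inj₁ (k , ag , xk , yk))
...   | true  | false = inj₂ (inj₁ (k , (λ m m<k → sym (ag m m<k)) , yk , xk))
...   | false | false = ⊥-elim (xk≢yk refl)
...   | true  | true  = ⊥-elim (xk≢yk refl)

compareBits-diag : ∀ b → compareBits b b ≡ 0
compareBits-diag false = refl
compareBits-diag true  = refl

prefixComparison-agree : ∀ {n} → AgreeBelow x y n → prefixComparison x y n ≡ 0
prefixComparison-agree {n = zero}          _  = refl
prefixComparison-agree {y = y} {n = suc n} ag
  rewrite prefixComparison-agree (λ m m<n → ag m (m<n⇒m<1+n m<n)) | ag n (n<1+n n) =
  compareBits-diag (y n)

prefixComparison-beyond : ∀ {k n} → AgreeBelow x y k → x k ≡ false → y k ≡ true →
  k < n → prefixComparison x y n ≡ 1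
prefixComparison-beyond {n = suc n} ag xk yk (s≤s k≤n) with m≤n⇒m<n∨m≡n k≤n
... | inj₁ k<n  rewrite prefixComparison-beyond ag xk yk k<n = refl
... | inj₂ refl rewrite prefixComparison-agree ag | xk | yk = refl

prefixComparison-≤lex : x ≤lex y → ∀ n →
  (prefixComparison x y n ≡ 0 × x n ≤ y n) ⊎ prefixComparison x y n ≡ 1
prefixComparison-≤lex (inj₂ x≗y) n =
  inj₁ (prefixComparison-agree {n = n} (λ m _ → x≗y m) , ≤-reflexive (x≗y n))
prefixComparison-≤lex (inj₁ (k , ag , xk , yk)) n with <-cmp n k
... | tri< n<k _ _ = inj₁ (prefixComparison-agree (λ m m<n → ag m (<-trans m<n n<k)) ,
                           ≤-reflexive (ag n n<k))
... | tri≈ _ refl _ = inj₁ (prefixComparison-agree ag , subst₂ _≤_ (sym xk) (sym yk) f≤t)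
... | tri> _ _ k<n = inj₂ (prefixComparison-beyond ag xk yk k<n)

x≤y⇒x∧y≡x : a ≤ b → a ∧ b ≡ a
x≤y⇒x∧y≡x f≤t = refl
x≤y⇒x∧y≡x b≤b = ∧-idem _

x≤y⇒x∨y≡y : a ≤ b → a ∨ b ≡ b
x≤y⇒x∨y≡y f≤t = refl
x≤y⇒x∨y≡y b≤b = ∨-idem _

lexMin-≤lex : x ≤lex y → lexMin x y ≗ x
lexMin-≤lex x≤y n with prefixComparison-≤lex x≤y n
... | inj₁ (c≡0 , xn≤yn) rewrite c≡0 = x≤y⇒x∧y≡x xn≤yn
... | inj₂ c≡1           rewrite c≡1 = refl

lexMax-≤lex : x ≤lex y → lexMax x y ≗ y
lexMax-≤lex x≤y n with prefixComparison-≤lex x≤y n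
... | inj₁ (c≡0 , xn≤yn) rewrite c≡0 = x≤y⇒x∨y≡y xn≤yn
... | inj₂ c≡1           rewrite c≡1 = refl

flipComparison : ℕ → ℕ
flipComparison n = pick n 0 2 1

compareBits-swap : ∀ a b → compareBits b a ≡ flipComparison (compareBits a b)
compareBits-swap false false = refl
compareBits-swap false true  = refl
compareBits-swap true  false = refl
compareBits-swap true  true  = refl

prefixComparison-swap : ∀ x y n → prefixComparison y x n ≡ flipComparison (prefixComparison x y n)
prefixComparison-swap x y zero = refl
prefixComparison-swap x y (suc n) rewrite prefixComparison-swap x y n = step (prefixComparison x y n)
  where
  step : ∀ s → if0 flipComparison s then compareBits (y n) (x n) else flipComparison s
             ≡ flipComparison (if0 s then compareBits (x n) (y n) else s)
  step zero          = compareBits-swap (x n) (y n)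
  step (suc zero)    = refl
  step (suc (suc _)) = refl

pick-flip : ∀ {A : Set} n (p q r : A) → pick (flipComparison n) p q r ≡ pick n p r q
pick-flip zero          p q r = refl
pick-flip (suc zero)    p q r = refl
pick-flip (suc (suc _)) p q r = refl

lexMin-comm : ∀ x y → lexMin x y ≗ lexMin y x
lexMin-comm x y n = begin
  pick cmp (x n ∧ y n) (x n) (y n)                      ≡⟨ cong (λ e → pick cmp e (x n) (y n)) (∧-comm (x n) (y n)) ⟩
  pick cmp (y n ∧ x n) (x n) (y n)                      ≡⟨ pick-flip cmp _ _ _ ⟨
  pick (flipComparison cmp) (y n ∧ x n) (y n) (x n)     ≡⟨ cong (λ t → pick t (y n ∧ x n) (y n) (x n)) (prefixComparison-swap x y n) ⟨
  lexMin y x n                                        ∎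
  where
  open ≡-Reasoning
  cmp : ℕ
  cmp = prefixComparison x y n

lexMax-comm : ∀ x y → lexMax x y ≗ lexMax y x
lexMax-comm x y n = begin
  pick cmp (x n ∨ y n) (y n) (x n)                      ≡⟨ cong (λ e → pick cmp e (y n) (x n)) (∨-comm (x n) (y n)) ⟩
  pick cmp (y n ∨ x n) (y n) (x n)                      ≡⟨ pick-flip cmp _ _ _ ⟨
  pick (flipComparison cmp) (y n ∨ x n) (x n) (y n)     ≡⟨ cong (λ t → pick t (y n ∨ x n) (x n) (y n)) (prefixComparison-swap x y n) ⟨
  lexMax y x n                                        ∎
  where
  open ≡-Reasoning
  cmp : ℕ
  cmp = prefixComparison x y n

s-resp-≗ : ∀ {α} → x ≗ y → s α x a → s α y b → a ≡ b
s-resp-≗ x≗y (inj₁ (refl , _))   (inj₁ (refl , _))   = refl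
s-resp-≗ x≗y (inj₂ (refl , _))   (inj₂ (refl , _))   = refl
s-resp-≗ x≗y (inj₁ (refl , x<α)) (inj₂ (refl , y≮α)) = ⊥-elim (y≮α (<lex-respˡ-≗ x≗y x<α))
s-resp-≗ x≗y (inj₂ (refl , x≮α)) (inj₁ (refl , y<α)) =
  ⊥-elim (x≮α (<lex-respˡ-≗ (λ n → sym (x≗y n)) y<α))

s-mono : ∀ {α} → x ≤lex y → s α x a → s α y b → a ≤ b
s-mono _   (inj₁ (refl , _))   _                   = ≤-minimum _
s-mono _   _                   (inj₂ (refl , _))   = ≤-maximum _
s-mono x≤y (inj₂ (refl , x≮α)) (inj₁ (refl , y<α)) = ⊥-elim (x≮α (≤lex-<lex-trans x≤y y<α))

s-total : LEM → ∀ α x → ∃ (s α x)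
s-total lem α x with lem {x <lex α}
... | yes x<α = false , inj₁ (refl , x<α)
... | no  x≮α = true  , inj₂ (refl , x≮α)

s-Homomorphic₂ : Cantor → (Cantor → Cantor → Cantor) → TruthTable → Set
s-Homomorphic₂ α _⊙_ _∙_ = ∀ {x y a b c} → s α x a → s α y b → s α (x ⊙ y) c → c ≡ a ∙ b

s-const : ∀ {α} → s-Homomorphic₂ α const const
s-const sa _ sc = s-resp-≗ (λ _ → refl) sc sa

s-constᵣ : ∀ {α} → s-Homomorphic₂ α constᵣ constᵣ
s-constᵣ _ sb sc = s-resp-≗ (λ _ → refl) sc sb

s-lexMin : LEM → ∀ {α} → s-Homomorphic₂ α lexMin _∧_
s-lexMin lem {x = x} {y} {a} {b} {c} sa sb sc with ≤lex-total lem x y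
... | inj₁ x≤y = begin
  c     ≡⟨ s-resp-≗ (lexMin-≤lex x≤y) sc sa ⟩
  a     ≡⟨ x≤y⇒x∧y≡x (s-mono x≤y sa sb) ⟨
  a ∧ b ∎
  where open ≡-Reasoning
... | inj₂ y≤x = begin
  c     ≡⟨ s-resp-≗ (λ n → trans (lexMin-comm x y n) (lexMin-≤lex y≤x n)) sc sb ⟩
  b     ≡⟨ x≤y⇒x∧y≡x (s-mono y≤x sb sa) ⟨
  b ∧ a ≡⟨ ∧-comm b a ⟩
  a ∧ b ∎
  where open ≡-Reasoning

s-lexMax : LEM → ∀ {α} → s-Homomorphic₂ α lexMax _∨_
s-lexMax lem {x = x} {y} {a} {b} {c} sa sb sc with ≤lex-total lem x y
... | inj₁ x≤y = begin
  c     ≡⟨ s-resp-≗ (lexMax-≤lex x≤y) sc sb ⟩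
  b     ≡⟨ x≤y⇒x∨y≡y (s-mono x≤y sa sb) ⟨
  a ∨ b ∎
  where open ≡-Reasoning
... | inj₂ y≤x = begin
  c     ≡⟨ s-resp-≗ (λ n → trans (lexMax-comm x y n) (lexMax-≤lex y≤x n)) sc sa ⟩
  a     ≡⟨ x≤y⇒x∨y≡y (s-mono y≤x sb sa) ⟨
  b ∨ a ≡⟨ ∨-comm b a ⟩
  a ∨ b ∎
  where open ≡-Reasoning

sF-≤sW : LEM → ∀ {F G : TruthTable} {α} {_⊙_ _⊛_ : Cantor → Cantor → Cantor} {f g : TruthTable} →
  ComputableOp _⊙_ → ComputableOp _⊛_ → s-Homomorphic₂ α _⊙_ f → s-Homomorphic₂ α _⊛_ g →
  (∀ a b → F (f a b) (g a b) ≡ G a b) → sF G α ≤sW sF F α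
sF-≤sW lem {F} {G} {α} {_⊙_} {_⊛_} {f} {g} ⊙-computable ⊛-computable ⊙-hom ⊛-hom FfgG =
  (λ p → proj₁ p ⊙ proj₂ p , proj₁ p ⊛ proj₂ p) , id , (⊙-computable , ⊛-computable) , reduce
  where
  reduce : ∀ z v → sF F α (proj₁ z ⊙ proj₂ z , proj₁ z ⊛ proj₂ z) v → sF G α z v
  reduce (x , y) v (c , d , sc , sd , v≡Fcd) with s-total lem α x | s-total lem α y
  ... | a , sa | b , sb = a , b , sa , sb , (begin
    v               ≡⟨ v≡Fcd ⟩
    F c d           ≡⟨ cong (λ t → F t d) (⊙-hom sa sb sc) ⟩
    F (f a b) d     ≡⟨ cong (F (f a b)) (⊛-hom sa sb sd) ⟩
    F (f a b) (g a b) ≡⟨ FfgG a b ⟩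
    G a b           ∎)
    where open ≡-Reasoning

biimpl-∨-revImpl : ∀ a b → biimpl (a ∨ b) a ≡ revImpl a b
biimpl-∨-revImpl false false = refl
biimpl-∨-revImpl false true  = refl
biimpl-∨-revImpl true  false = refl
biimpl-∨-revImpl true  true  = refl

revImpl-∧-∨-biimpl : ∀ a b → revImpl (a ∧ b) (a ∨ b) ≡ biimpl a b
revImpl-∧-∨-biimpl false false = refl
revImpl-∧-∨-biimpl false true  = refl
revImpl-∧-∨-biimpl true  false = refl
revImpl-∧-∨-biimpl true  true  = refl

mainTheorem11 : ExcludedMiddle Level.zero → (α : Cantor) →
    (sF impl α ≡sW sF revImpl α) × (sF revImpl α ≡sW sF biimpl α)
mainTheorem11 lem α =
  ( sF-≤sW lem constᵣ-computable const-computable s-constᵣ s-const (λ _ _ → refl)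
  , sF-≤sW lem constᵣ-computable const-computable s-constᵣ s-const (λ _ _ → refl) )
  , ( sF-≤sW lem lexMax-computable const-computable (s-lexMax lem) s-const biimpl-∨-revImpl
    , sF-≤sW lem lexMin-computable lexMax-computable (s-lexMin lem) (s-lexMax lem) revImpl-∧-∨-biimpl )
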